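{- Let $\mathcal{P}=(N,\preccurlyeq)$ be a finite poset with $N=\{1,\dots,n\}$. Let $G_0=(U,V;E_0)$ be the bipartite graph with $U=\{u_1,\dots,u_n\}$, $V=\{v_1,\dots,v_n\}$ and $E_0=\{\{u_i,v_j\} : j\preccurlyeq i \text{ in } \mathcal{P}\}$, and let $w_0\colon E_0\to\mathbb{Z}_{\ge0}$ be given by $w_0(\{u_i,v_j\})=0$ if $i=j$ and $w_0(\{u_i,v_j\})=1$ otherwise. Define $f_0\colon 2^N\to\mathbb{R}$ by \[ f_0(X)=\max\{\, w_0(M) : M\subseteq E_0 \text{ is a matching with } \partial M\cap U=U_X \,\}, \] where $w_0(M)=\sum_{e\in M}w_0(e)$ and $U_X=\{u_i : i\in X\}$. Then $f_0$ is $\mathrm{M}^\natural$-concave, and for every $X\subseteq N$, $f_0(X)=0$ if $X\in\mathcal{I}(\mathcal{P})$ and $f_0(X)>0$ otherwise.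
   Context: A matching is a set $M$ of edges no two of which share an endpoint; $\partial M$ denotes the set of vertices incident to some edge of $M$. (For every $X$ the matching $\{\{u_i,v_i\}: i\in X\}$ is feasible, so $f_0$ is finite.) For a finite poset, an ideal is a subset $I\subseteq N$ with $x\preccurlyeq y\in I\Rightarrow x\in I$; $\mathcal{I}(\mathcal{P})$ is the set of all ideals. A set function $f\colon 2^N\to\mathbb{R}$ is $\mathrm{M}^\natural$-concave if for all $X,Y\subseteq N$ and every $i\in X\setminus Y$, either $f(X)+f(Y)\le f(X\setminus\{i\})+f(Y\cup\{i\})$, or there exists $j\in Y\setminus X$ with $f(X)+f(Y)\le f((X\setminus\{i\})\cup\{j\})+f((Y\cup\{i\})\setminus\{j\})$. -}

module Defs where

open import Data.Nat using (ℕ; _+_; _≤_)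
open import Data.Bool using (Bool; true; false; if_then_else_)
open import Data.Fin using (Fin)
open import Data.Fin.Properties using (_≟_)
open import Data.Fin.Subset using (Subset; _∈_; _∉_; _∪_; _-_; ⁅_⁆)
open import Data.Vec using (tabulate; sum)
open import Data.Product using (Σ; ∃; _×_; _,_)
open import Data.Sum using (_⊎_)
open import Relation.Nullary using (¬_; Dec; yes; no)
open import Relation.Binary.PropositionalEquality using (_≡_)
open import Function.Bundles using (_⇔_)

Σ[_] : ∀ {n} → (Fin n → ℕ) → ℕ
Σ[ f ] = sum (tabulate f)

-- An edge set of the bipartite graph (U,V) with U = {u_i}, V = {v_j}, i,j ∈ Fin n:
-- M i j ≡ true  iff the edge {u_i , v_j} belongs to M.
EdgeSet : ℕ → Set
EdgeSet n = Fin n → Fin n → Bool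

w₀ : ∀ {n} → Fin n → Fin n → ℕ
w₀ i j with i ≟ j
... | yes _ = 0
... | no  _ = 1

weight : ∀ {n} → EdgeSet n → ℕ
weight M = Σ[ (λ i → Σ[ (λ j → if M i j then w₀ i j else 0) ] ) ]

InE₀ : ∀ {n} (_≼_ : Fin n → Fin n → Set) → EdgeSet n → Set
InE₀ _≼_ M = ∀ i j → M i j ≡ true → j ≼ i

IsMatching : ∀ {n} → EdgeSet n → Set
IsMatching M =
  (∀ i j j′ → M i j ≡ true → M i j′ ≡ true → j ≡ j′) ×
  (∀ i i′ j → M i j ≡ true → M i′ j ≡ true → i ≡ i′)

BoundaryU : ∀ {n} → EdgeSet n → Subset n → Set
BoundaryU M X = ∀ i → (i ∈ X ⇔ ∃ λ j → M i j ≡ true)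

Feasible : ∀ {n} (_≼_ : Fin n → Fin n → Set) → Subset n → EdgeSet n → Set
Feasible _≼_ X M = InE₀ _≼_ M × IsMatching M × BoundaryU M X

IsMaxValue : ∀ {n} (_≼_ : Fin n → Fin n → Set) → Subset n → ℕ → Set
IsMaxValue _≼_ X v =
  (Σ (EdgeSet _) λ M → Feasible _≼_ X M × weight M ≡ v) ×
  (∀ M → Feasible _≼_ X M → weight M ≤ v)

IsIdeal : ∀ {n} (_≼_ : Fin n → Fin n → Set) → Subset n → Set
IsIdeal _≼_ I = ∀ x y → x ≼ y → y ∈ I → x ∈ I

MnatConcave : ∀ {n} → (Subset n → ℕ) → Set
MnatConcave f = ∀ X Y i → i ∈ X → i ∉ Y →
  (f X + f Y ≤ f (X - i) + f (Y ∪ ⁅ i ⁆)) ⊎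
  (∃ λ j → j ∈ Y × j ∉ X ×
     (f X + f Y ≤ f ((X - i) ∪ ⁅ j ⁆) + f ((Y ∪ ⁅ i ⁆) - j)))

-- M♮-concavity is the classical exchange argument for weighted bipartite
-- matchings and uses nothing about the poset: given optimal matchings A for X
-- and B for Y and i ∈ X ∖ Y, follow the alternating path that starts with the
-- A-edge at u_i.  Exchanging its A-edges and B-edges between the two matchings
-- gives feasible matchings for X - i and Y + i if the path ends at a vertex v,
-- and for X - i + j and Y + i - j if it ends at some u_j with j ∉ X.  Either way
-- the two new matchings use exactly the edges of A and B, so their weights add
-- up to f₀ X + f₀ Y.
--
-- For the values of f₀: if X is an ideal and M is feasible for X, the map τ
-- sending i ∈ X to the j with {u_i , v_j} ∈ M and fixing N ∖ X satisfies
-- τ(i) ≼ i, and it is injective because the partners of X stay in X.  Such a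
-- map is the identity: by pigeonhole some iterate τ^(d+1) fixes i, whence
-- i ≼ τ(i).  So every edge of M is diagonal.
-- If X is not an ideal, say x ≼ y ∈ X ∌ x, the identity matching on X with
-- {u_y , v_x} in place of {u_y , v_y} has weight 1.
module Submission where

open import Defs
open import Algebra.Properties.CommutativeSemigroup using (interchange)
open import Data.Bool using (Bool; true; false; if_then_else_)
open import Data.Bool.Properties using (¬-not) renaming (_≟_ to _≟ᵇ_)
open import Data.Fin using (Fin; zero; suc; toℕ)
open import Data.Fin.Properties using (_≟_; any?; pigeonhole)
open import Data.Fin.Subset
  using (Subset; _∈_; _∉_; _∪_; _-_; _─_; ⁅_⁆; ∣_∣; outside)
open import Data.Fin.Subset.Properties
  using (_∈?_; x∈p∪q⁻; x∈p∪q⁺; x∈⁅x⁆; x∈⁅y⁆⇒x≡y; x∈p∧x≢y⇒x∈p-y;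
         p─q⊆p; p─x─y≡p─y─x; x∈p⇒∣p-x∣<∣p∣; ⊆-antisym; ∪-assoc; ∪-comm)
open import Data.Nat using (ℕ; zero; suc; _+_; _*_; _≤_; _<_)
open import Data.Nat.Induction using (<-wellFounded)
open import Data.Nat.Properties
  using (+-commutativeSemigroup; +-suc; +-identityʳ; *-distribʳ-+;
         m≤m+n; m≤n+m; ≤-trans; +-mono-≤; n≢0⇒n>0; m≤n⇒∃[o]m+o≡n; n<1+n)
open import Data.Product using (∃; ∃₂; _×_; _,_; proj₁; proj₂)
open import Data.Sum using (_⊎_; inj₁; inj₂; [_,_])
open import Data.Vec.Base using (_∷_; there)
open import Function using (_∘_)
open import Function.Bundles using (mk⇔; Equivalence)
open import Function.Definitions using (Injective)
open import Induction.WellFounded using (Acc; acc)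
open import Relation.Binary.PropositionalEquality
  using (_≡_; _≢_; _≗_; refl; sym; trans; cong; cong₂; subst; subst₂; module ≡-Reasoning)
open import Relation.Binary.Structures using (IsPartialOrder)
open import Relation.Nullary using (¬_; Dec; yes; no; contradiction; _×-dec_)

open ≡-Reasoning

Σ-+-cong : ∀ {n} {f g h k : Fin n → ℕ} → (∀ i → f i + g i ≡ h i + k i) →
           Σ[ f ] + Σ[ g ] ≡ Σ[ h ] + Σ[ k ]
Σ-+-cong {zero}  eq = refl
Σ-+-cong {suc n} {f} {g} {h} {k} eq = begin
  (f zero + Σ[ f ∘ suc ]) + (g zero + Σ[ g ∘ suc ])  ≡⟨ ⇄ (f zero) Σ[ f ∘ suc ] (g zero) _ ⟩
  (f zero + g zero) + (Σ[ f ∘ suc ] + Σ[ g ∘ suc ])  ≡⟨ cong₂ _+_ (eq zero) (Σ-+-cong (eq ∘ suc)) ⟩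
  (h zero + k zero) + (Σ[ h ∘ suc ] + Σ[ k ∘ suc ])  ≡⟨ ⇄ (h zero) (k zero) Σ[ h ∘ suc ] _ ⟩
  (h zero + Σ[ h ∘ suc ]) + (k zero + Σ[ k ∘ suc ])  ∎
  where ⇄ = interchange +-commutativeSemigroup

Σ-zero : ∀ {n} {f : Fin n → ℕ} → (∀ i → f i ≡ 0) → Σ[ f ] ≡ 0
Σ-zero {zero}  eq = refl
Σ-zero {suc n} eq = cong₂ _+_ (eq zero) (Σ-zero (eq ∘ suc))

≤-Σ : ∀ {n} (f : Fin n → ℕ) k → f k ≤ Σ[ f ]
≤-Σ f zero    = m≤m+n _ _
≤-Σ f (suc k) = ≤-trans (≤-Σ (f ∘ suc) k) (m≤n+m _ _)

⟦_⟧ : Bool → ℕ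
⟦ true  ⟧ = 1
⟦ false ⟧ = 0

if-then-0≡⟦⟧* : ∀ b w → (if b then w else 0) ≡ ⟦ b ⟧ * w
if-then-0≡⟦⟧* true  w = sym (+-identityʳ w)
if-then-0≡⟦⟧* false w = refl

⟦⟧-+-true : ∀ {a b c d} → ⟦ a ⟧ + ⟦ b ⟧ ≡ ⟦ c ⟧ + ⟦ d ⟧ → c ≡ true → b ≡ false → a ≡ true
⟦⟧-+-true {true}                   _  _    _    = refl
⟦⟧-+-true {false} {false} {true} () refl refl

⟦⟧-+-covered : ∀ {a b c d} → ⟦ a ⟧ + ⟦ b ⟧ ≡ ⟦ c ⟧ + ⟦ d ⟧ → b ≡ true → c ≡ true ⊎ d ≡ true
⟦⟧-+-covered {c = true}                        _  _    = inj₁ refl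
⟦⟧-+-covered {c = false} {true}                _  _    = inj₂ refl
⟦⟧-+-covered {true}  {true} {false} {false} () refl
⟦⟧-+-covered {false} {true} {false} {false} () refl

w₀-refl : ∀ {n} (x : Fin n) → w₀ x x ≡ 0
w₀-refl x with x ≟ x
... | yes _   = refl
... | no  x≢x = contradiction refl x≢x

w₀-≢ : ∀ {n} {x y : Fin n} → x ≢ y → w₀ x y ≡ 1
w₀-≢ {x = x} {y} x≢y with x ≟ y
... | yes x≡y = contradiction x≡y x≢y
... | no  _   = refl

_⊕_ : ∀ {n} → EdgeSet n → EdgeSet n → Fin n × Fin n → ℕ
(M ⊕ M′) (x , y) = ⟦ M x y ⟧ + ⟦ M′ x y ⟧

weight-⊕ : ∀ {n} {M₁ M₂ A B : EdgeSet n} → M₁ ⊕ M₂ ≗ A ⊕ B →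
           weight M₁ + weight M₂ ≡ weight A + weight B
weight-⊕ {M₁ = M₁} {M₂} {A} {B} eq = Σ-+-cong λ i → Σ-+-cong λ j → entry i j
  where
  entry : ∀ i j → (if M₁ i j then w₀ i j else 0) + (if M₂ i j then w₀ i j else 0)
                ≡ (if A i j then w₀ i j else 0) + (if B i j then w₀ i j else 0)
  entry i j = begin
    (if M₁ i j then w else 0) + (if M₂ i j then w else 0)
      ≡⟨ cong₂ _+_ (if-then-0≡⟦⟧* (M₁ i j) w) (if-then-0≡⟦⟧* (M₂ i j) w) ⟩
    ⟦ M₁ i j ⟧ * w + ⟦ M₂ i j ⟧ * w  ≡⟨ *-distribʳ-+ w ⟦ M₁ i j ⟧ ⟦ M₂ i j ⟧ ⟨
    (M₁ ⊕ M₂) (i , j) * w            ≡⟨ cong (_* w) (eq (i , j)) ⟩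
    (A ⊕ B) (i , j) * w              ≡⟨ *-distribʳ-+ w ⟦ A i j ⟧ ⟦ B i j ⟧ ⟩
    ⟦ A i j ⟧ * w + ⟦ B i j ⟧ * w
      ≡⟨ cong₂ _+_ (if-then-0≡⟦⟧* (A i j) w) (if-then-0≡⟦⟧* (B i j) w) ⟨
    (if A i j then w else 0) + (if B i j then w else 0)  ∎
    where w = w₀ i j

weight-diagonal : ∀ {n} {M : EdgeSet n} → (∀ x y → M x y ≡ true → x ≡ y) → weight M ≡ 0
weight-diagonal {M = M} diagonal = Σ-zero λ x → Σ-zero λ y → entry x y
  where
  entry : ∀ x y → (if M x y then w₀ x y else 0) ≡ 0
  entry x y with M x y in e
  ... | true  = subst (λ z → w₀ x z ≡ 0) (diagonal x y e) (w₀-refl x)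
  ... | false = refl

w₀≤weight : ∀ {n} {M : EdgeSet n} {x y} → M x y ≡ true → w₀ x y ≤ weight M
w₀≤weight {M = M} {x} {y} e =
  subst (λ b → (if b then w₀ x y else 0) ≤ weight M) e
    (≤-trans (≤-Σ (λ j → if M x j then w₀ x j else 0) y)
             (≤-Σ (λ i → Σ[ (λ j → if M i j then w₀ i j else 0) ]) x))

setEdge : ∀ {n} → Fin n → Fin n → Bool → EdgeSet n → EdgeSet n
setEdge a b β M x y with (x ≟ a) ×-dec (y ≟ b)
... | yes _ = β
... | no  _ = M x y

insertEdge deleteEdge : ∀ {n} → Fin n → Fin n → EdgeSet n → EdgeSet n
insertEdge a b = setEdge a b true
deleteEdge a b = setEdge a b false

setEdge-hit : ∀ {n} (a b : Fin n) β M → setEdge a b β M a b ≡ β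
setEdge-hit a b β M with (a ≟ a) ×-dec (b ≟ b)
... | yes _ = refl
... | no ¬p = contradiction (refl , refl) ¬p

setEdge-miss : ∀ {n} {a b x y : Fin n} β M → ¬ (x ≡ a × y ≡ b) → setEdge a b β M x y ≡ M x y
setEdge-miss {a = a} {b} {x} {y} β M ¬p with (x ≟ a) ×-dec (y ≟ b)
... | yes p = contradiction p ¬p
... | no  _ = refl

insertEdge⁻ : ∀ {n} (a b x y : Fin n) {M} → insertEdge a b M x y ≡ true →
              (x ≡ a × y ≡ b) ⊎ M x y ≡ true
insertEdge⁻ a b x y e with (x ≟ a) ×-dec (y ≟ b)
... | yes p = inj₁ p
... | no  _ = inj₂ e

deleteEdge⁻ : ∀ {n} (a b x y : Fin n) {M} → deleteEdge a b M x y ≡ true →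
              M x y ≡ true × ¬ (x ≡ a × y ≡ b)
deleteEdge⁻ a b x y e with (x ≟ a) ×-dec (y ≟ b)
... | no ¬p = e , ¬p

⊕-move : ∀ {n} {a b : Fin n} {P Q} → P a b ≡ true → Q a b ≡ false →
         deleteEdge a b P ⊕ insertEdge a b Q ≗ P ⊕ Q
⊕-move {a = a} {b} Pab Qab (x , y) with (x ≟ a) ×-dec (y ≟ b)
... | yes (refl , refl) rewrite Pab | Qab = refl
... | no _ = refl

⊕-insert : ∀ {n} {a b : Fin n} {P R S Q} → P a b ≡ false → Q a b ≡ true →
           P ⊕ R ≗ S ⊕ deleteEdge a b Q → insertEdge a b P ⊕ R ≗ S ⊕ Q
⊕-insert {a = a} {b} {P} {R} {S} {Q} Pab Qab eq (x , y) with (x ≟ a) ×-dec (y ≟ b)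
... | yes (refl , refl) = begin
  suc ⟦ R x y ⟧                        ≡⟨ cong suc (trans (cong (λ β → ⟦ β ⟧ + _) (sym Pab)) (eq (x , y))) ⟩
  suc (⟦ S x y ⟧ + ⟦ deleteEdge x y Q x y ⟧)
                                       ≡⟨ cong (λ β → suc (_ + ⟦ β ⟧)) (setEdge-hit x y false Q) ⟩
  suc (⟦ S x y ⟧ + 0)                  ≡⟨ +-suc _ 0 ⟨
  ⟦ S x y ⟧ + 1                        ≡⟨ cong (λ β → _ + ⟦ β ⟧) Qab ⟨
  ⟦ S x y ⟧ + ⟦ Q x y ⟧                ∎
... | no ¬p = begin
  ⟦ P x y ⟧ + ⟦ R x y ⟧                 ≡⟨ eq (x , y) ⟩
  ⟦ S x y ⟧ + ⟦ deleteEdge a b Q x y ⟧  ≡⟨ cong (λ β → _ + ⟦ β ⟧) (setEdge-miss false Q ¬p) ⟩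
  ⟦ S x y ⟧ + ⟦ Q x y ⟧                 ∎

x∈p─q⇒x∉q : ∀ {n} {x : Fin n} (p q : Subset n) → x ∈ p ─ q → x ∉ q
x∈p─q⇒x∉q {x = zero}  (_ ∷ p) (outside ∷ q) _         ()
x∈p─q⇒x∉q {x = suc x} (_ ∷ p) (_       ∷ q) (there h) (there h′) = x∈p─q⇒x∉q p q h h′

x∈p-y⇒x≢y : ∀ {n} {x y : Fin n} {p} → x ∈ p - y → x ≢ y
x∈p-y⇒x≢y {y = y} {p} h refl = x∈p─q⇒x∉q p ⁅ y ⁆ h (x∈⁅x⁆ y)

x∈p∧y∉p⇒x≢y : ∀ {n} {x y : Fin n} {p} → x ∈ p → y ∉ p → x ≢ y
x∈p∧y∉p⇒x≢y x∈p y∉p refl = y∉p x∈p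

x∈p⇒p-x∪⁅x⁆≡p : ∀ {n} {x : Fin n} {p} → x ∈ p → (p - x) ∪ ⁅ x ⁆ ≡ p
x∈p⇒p-x∪⁅x⁆≡p {x = x} {p} x∈p = ⊆-antisym ⊆ ⊇
  where
  ⊆ : ∀ {k} → k ∈ (p - x) ∪ ⁅ x ⁆ → k ∈ p
  ⊆ h = [ p─q⊆p p ⁅ x ⁆ , (λ k∈⁅x⁆ → subst (_∈ p) (sym (x∈⁅y⁆⇒x≡y x k∈⁅x⁆)) x∈p) ]
          (x∈p∪q⁻ (p - x) ⁅ x ⁆ h)
  ⊇ : ∀ {k} → k ∈ p → k ∈ (p - x) ∪ ⁅ x ⁆
  ⊇ {k} k∈p with k ≟ x
  ... | yes refl = x∈p∪q⁺ (inj₂ (x∈⁅x⁆ x))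
  ... | no  k≢x  = x∈p∪q⁺ (inj₁ (x∈p∧x≢y⇒x∈p-y k∈p k≢x))

x≢y⇒p-x∪⁅y⁆≡p∪⁅y⁆-x : ∀ {n} {x y : Fin n} {p} → x ≢ y → (p - x) ∪ ⁅ y ⁆ ≡ (p ∪ ⁅ y ⁆) - x
x≢y⇒p-x∪⁅y⁆≡p∪⁅y⁆-x {x = x} {y} {p} x≢y = ⊆-antisym ⊆ ⊇
  where
  ⊆ : ∀ {k} → k ∈ (p - x) ∪ ⁅ y ⁆ → k ∈ (p ∪ ⁅ y ⁆) - x
  ⊆ h with x∈p∪q⁻ (p - x) ⁅ y ⁆ h
  ... | inj₁ k∈p-x = x∈p∧x≢y⇒x∈p-y (x∈p∪q⁺ (inj₁ (p─q⊆p p ⁅ x ⁆ k∈p-x))) (x∈p-y⇒x≢y {p = p} k∈p-x)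
  ... | inj₂ k∈⁅y⁆ with x∈⁅y⁆⇒x≡y y k∈⁅y⁆
  ...   | refl = x∈p∧x≢y⇒x∈p-y (x∈p∪q⁺ (inj₂ k∈⁅y⁆)) (x≢y ∘ sym)
  ⊇ : ∀ {k} → k ∈ (p ∪ ⁅ y ⁆) - x → k ∈ (p - x) ∪ ⁅ y ⁆
  ⊇ h = [ (λ k∈p → x∈p∪q⁺ (inj₁ (x∈p∧x≢y⇒x∈p-y k∈p (x∈p-y⇒x≢y {p = p ∪ ⁅ y ⁆} h)))) ,
          (λ k∈⁅y⁆ → x∈p∪q⁺ (inj₂ k∈⁅y⁆)) ]
        (x∈p∪q⁻ p ⁅ y ⁆ (p─q⊆p (p ∪ ⁅ y ⁆) ⁅ x ⁆ h))

x∈p∧x≢y⇒p-x-y∪⁅x⁆≡p-y : ∀ {n} {x y : Fin n} {p} → x ∈ p → x ≢ y → (p - x - y) ∪ ⁅ x ⁆ ≡ p - y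
x∈p∧x≢y⇒p-x-y∪⁅x⁆≡p-y {x = x} {y} {p} x∈p x≢y = begin
  (p - x - y) ∪ ⁅ x ⁆  ≡⟨ cong (_∪ ⁅ x ⁆) (p─x─y≡p─y─x p x y) ⟩
  (p - y - x) ∪ ⁅ x ⁆  ≡⟨ x∈p⇒p-x∪⁅x⁆≡p (x∈p∧x≢y⇒x∈p-y x∈p x≢y) ⟩
  p - y                ∎

module Exchange {n : ℕ} (_≼_ : Fin n → Fin n → Set) where

  private variable
    X Y X′ Y′ : Subset n
    A B M P Q : EdgeSet n
    a b i u v : Fin n

  Uncovered : EdgeSet n → Fin n → Set
  Uncovered M b = ∀ x → M x b ≢ true

  covered : Feasible _≼_ X M → M a b ≡ true → a ∈ X
  covered (_ , _ , boundary) Mab = Equivalence.from (boundary _) (_ , Mab)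

  partner : Feasible _≼_ X M → a ∈ X → ∃ λ b → M a b ≡ true
  partner (_ , _ , boundary) = Equivalence.to (boundary _)

  deleteEdge-feasible : Feasible _≼_ X M → M a b ≡ true → Feasible _≼_ (X - a) (deleteEdge a b M)
  deleteEdge-feasible {X} {M} {a} {b} F@(inE₀ , (rowUnique , colUnique) , _) Mab =
    (λ x y → inE₀ x y ∘ old) ,
    ((λ x y y′ e e′ → rowUnique x y y′ (old e) (old e′)) ,
     (λ x x′ y e e′ → colUnique x x′ y (old e) (old e′))) ,
    λ k → mk⇔ to from
    where
    old : ∀ {x y} → deleteEdge a b M x y ≡ true → M x y ≡ true
    old {x} {y} = proj₁ ∘ deleteEdge⁻ a b x y
    to : ∀ {k} → k ∈ X - a → ∃ λ y → deleteEdge a b M k y ≡ true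
    to {k} k∈X-a =
      let (y , Mky) = partner F (p─q⊆p X ⁅ a ⁆ k∈X-a)
      in y , trans (setEdge-miss false M (x∈p-y⇒x≢y {p = X} k∈X-a ∘ proj₁)) Mky
    from : ∀ {k} → (∃ λ y → deleteEdge a b M k y ≡ true) → k ∈ X - a
    from {k} (y , e) =
      let (Mky , ¬hit) = deleteEdge⁻ a b k y e
      in x∈p∧x≢y⇒x∈p-y (covered F Mky)
           (λ { refl → ¬hit (refl , rowUnique k y b Mky Mab) })

  insertEdge-feasible : Feasible _≼_ X M → a ∉ X → Uncovered M b → b ≼ a →
                        Feasible _≼_ (X ∪ ⁅ a ⁆) (insertEdge a b M)
  insertEdge-feasible {X} {M} {a} {b} F@(inE₀ , (rowUnique , colUnique) , _) a∉X free b≼a =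
    inE₀′ , (rowUnique′ , colUnique′) , λ k → mk⇔ to from
    where
    new-row : ∀ {x y} → M x y ≡ true → x ≢ a
    new-row Mxy refl = a∉X (covered F Mxy)
    new-col : ∀ {x y} → M x y ≡ true → y ≢ b
    new-col Mxy refl = free _ Mxy
    inE₀′ : InE₀ _≼_ (insertEdge a b M)
    inE₀′ x y e with insertEdge⁻ a b x y e
    ... | inj₁ (refl , refl) = b≼a
    ... | inj₂ Mxy           = inE₀ x y Mxy
    rowUnique′ : ∀ x y y′ → insertEdge a b M x y ≡ true → insertEdge a b M x y′ ≡ true → y ≡ y′
    rowUnique′ x y y′ e e′ with insertEdge⁻ a b x y e | insertEdge⁻ a b x y′ e′
    ... | inj₁ (_ , refl) | inj₁ (_ , refl) = refl
    ... | inj₁ (x≡a , _)  | inj₂ Mxy′       = contradiction x≡a (new-row Mxy′)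
    ... | inj₂ Mxy        | inj₁ (x≡a , _)  = contradiction x≡a (new-row Mxy)
    ... | inj₂ Mxy        | inj₂ Mxy′       = rowUnique x y y′ Mxy Mxy′
    colUnique′ : ∀ x x′ y → insertEdge a b M x y ≡ true → insertEdge a b M x′ y ≡ true → x ≡ x′
    colUnique′ x x′ y e e′ with insertEdge⁻ a b x y e | insertEdge⁻ a b x′ y e′
    ... | inj₁ (refl , _) | inj₁ (refl , _) = refl
    ... | inj₁ (_ , y≡b)  | inj₂ Mx′y       = contradiction y≡b (new-col Mx′y)
    ... | inj₂ Mxy        | inj₁ (_ , y≡b)  = contradiction y≡b (new-col Mxy)
    ... | inj₂ Mxy        | inj₂ Mx′y       = colUnique x x′ y Mxy Mx′y
    to : ∀ {k} → k ∈ X ∪ ⁅ a ⁆ → ∃ λ y → insertEdge a b M k y ≡ true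
    to {k} h with x∈p∪q⁻ X ⁅ a ⁆ h
    ... | inj₁ k∈X = let (y , Mky) = partner F k∈X
                     in y , trans (setEdge-miss true M (new-row Mky ∘ proj₁)) Mky
    ... | inj₂ k∈⁅a⁆ with x∈⁅y⁆⇒x≡y a k∈⁅a⁆
    ...   | refl = b , setEdge-hit k b true M
    from : ∀ {k} → (∃ λ y → insertEdge a b M k y ≡ true) → k ∈ X ∪ ⁅ a ⁆
    from {k} (y , e) with insertEdge⁻ a b k y e
    ... | inj₁ (refl , _) = x∈p∪q⁺ (inj₂ (x∈⁅x⁆ a))
    ... | inj₂ Mky        = x∈p∪q⁺ (inj₁ (covered F Mky))

  Rematch : EdgeSet n → EdgeSet n → Subset n → Subset n → Set
  Rematch A B X′ Y′ = ∃₂ λ M₁ M₂ →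
    Feasible _≼_ X′ M₁ × Feasible _≼_ Y′ M₂ × M₁ ⊕ M₂ ≗ A ⊕ B

  moveEdge : Feasible _≼_ X P → Feasible _≼_ Y Q → P a b ≡ true → Uncovered Q b → a ∉ Y →
             Rematch P Q (X - a) (Y ∪ ⁅ a ⁆)
  moveEdge FP FQ Pab free a∉Y =
    _ , _ , deleteEdge-feasible FP Pab ,
    insertEdge-feasible FQ a∉Y free (proj₁ FP _ _ Pab) ,
    ⊕-move Pab (¬-not (free _))

  -- One more step of the alternating path i →A v →B u.
  extendRematch : Feasible _≼_ X A → Feasible _≼_ Y B → A i v ≡ true → B u v ≡ true →
                  Rematch A (deleteEdge u v B) X′ Y′ → i ∉ Y′ → u ∉ X′ →
                  Rematch A B ((X′ - i) ∪ ⁅ u ⁆) (Y′ ∪ ⁅ i ⁆)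
  extendRematch {i = i} {v = v} {u = u} {X′ = X′}
                (_ , (_ , colUniqueA) , _) (inE₀B , (_ , colUniqueB) , _) Aiv Buv
                (M₁ , M₂ , F₁ , F₂ , rematch) i∉Y′ u∉X′ =
    let (M₁⁻ , M₂⁺ , F₁⁻ , F₂⁺ , moved) = moveEdge F₁ F₂ M₁iv M₂-free i∉Y′
        M₁⁻-free : Uncovered M₁⁻ v
        M₁⁻-free x e = let (M₁xv , ¬hit) = deleteEdge⁻ i v x v e
                       in ¬hit (colUnique₁ x i v M₁xv M₁iv , refl)
    in _ , _ ,
       insertEdge-feasible F₁⁻ (u∉X′ ∘ p─q⊆p X′ ⁅ i ⁆) M₁⁻-free (inE₀B u v Buv) , F₂⁺ ,
       ⊕-insert (¬-not (M₁⁻-free u)) Buv (λ e → trans (moved e) (rematch e))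
    where
    colUnique₁ = proj₂ (proj₁ (proj₂ F₁))
    M₂iv : M₂ i v ≡ false
    M₂iv = ¬-not (i∉Y′ ∘ covered F₂)
    M₁iv : M₁ i v ≡ true
    M₁iv = ⟦⟧-+-true (rematch (i , v)) Aiv M₂iv
    M₂-free : Uncovered M₂ v
    M₂-free x M₂xv with ⟦⟧-+-covered (rematch (x , v)) M₂xv
    ... | inj₁ Axv with colUniqueA x i v Axv Aiv
    ...   | refl = contradiction (trans (sym M₂iv) M₂xv) λ ()
    M₂-free x M₂xv | inj₂ B⁻xv =
      let (Bxv , ¬hit) = deleteEdge⁻ u v x v B⁻xv in ¬hit (colUniqueB x u v Bxv Buv , refl)

  data Exchanged (X Y : Subset n) (i : Fin n) : Subset n → Subset n → Set where
    drop : Exchanged X Y i (X - i) (Y ∪ ⁅ i ⁆)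
    swap : ∀ j → j ∈ Y → j ∉ X → Exchanged X Y i ((X - i) ∪ ⁅ j ⁆) ((Y ∪ ⁅ i ⁆) - j)

  Exchanged-extend : u ∈ X → u ∈ Y → i ∉ Y → Exchanged X (Y - u) u X′ Y′ →
                     i ∉ Y′ × u ∉ X′ × Exchanged X Y i ((X′ - i) ∪ ⁅ u ⁆) (Y′ ∪ ⁅ i ⁆)
  Exchanged-extend {u} {X} {Y} {i} u∈X u∈Y i∉Y drop
    rewrite x∈p⇒p-x∪⁅x⁆≡p u∈Y =
    i∉Y , (λ u∈X-u → x∈p-y⇒x≢y {p = X} u∈X-u refl) ,
    subst (λ X″ → Exchanged X Y i X″ (Y ∪ ⁅ i ⁆))
          (sym (x∈p∧x≢y⇒p-x-y∪⁅x⁆≡p-y u∈X (x∈p∧y∉p⇒x≢y u∈Y i∉Y))) drop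
  Exchanged-extend {u} {X} {Y} {i} u∈X u∈Y i∉Y (swap j j∈Y-u j∉X)
    rewrite x∈p⇒p-x∪⁅x⁆≡p u∈Y =
    i∉Y ∘ p─q⊆p Y ⁅ j ⁆ , u∉X′ ,
    subst₂ (Exchanged X Y i) (sym X-eq) (sym (x≢y⇒p-x∪⁅y⁆≡p∪⁅y⁆-x j≢i)) (swap j j∈Y j∉X)
    where
    j∈Y = p─q⊆p Y ⁅ u ⁆ j∈Y-u
    j≢i = x∈p∧y∉p⇒x≢y j∈Y i∉Y
    u≢i = x∈p∧y∉p⇒x≢y u∈Y i∉Y
    u∉X′ : u ∉ (X - u) ∪ ⁅ j ⁆
    u∉X′ h = [ (λ u∈X-u → x∈p-y⇒x≢y {p = X} u∈X-u refl) ,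
               (λ u∈⁅j⁆ → x∈p∧y∉p⇒x≢y u∈X j∉X (x∈⁅y⁆⇒x≡y j u∈⁅j⁆)) ]
             (x∈p∪q⁻ (X - u) ⁅ j ⁆ h)
    X-eq : (((X - u) ∪ ⁅ j ⁆) - i) ∪ ⁅ u ⁆ ≡ (X - i) ∪ ⁅ j ⁆
    X-eq = begin
      (((X - u) ∪ ⁅ j ⁆) - i) ∪ ⁅ u ⁆  ≡⟨ cong (_∪ ⁅ u ⁆) (x≢y⇒p-x∪⁅y⁆≡p∪⁅y⁆-x (j≢i ∘ sym)) ⟨
      ((X - u - i) ∪ ⁅ j ⁆) ∪ ⁅ u ⁆    ≡⟨ ∪-assoc (X - u - i) ⁅ j ⁆ ⁅ u ⁆ ⟩
      (X - u - i) ∪ (⁅ j ⁆ ∪ ⁅ u ⁆)    ≡⟨ cong ((X - u - i) ∪_) (∪-comm ⁅ j ⁆ ⁅ u ⁆) ⟩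
      (X - u - i) ∪ (⁅ u ⁆ ∪ ⁅ j ⁆)    ≡⟨ ∪-assoc (X - u - i) ⁅ u ⁆ ⁅ j ⁆ ⟨
      ((X - u - i) ∪ ⁅ u ⁆) ∪ ⁅ j ⁆    ≡⟨ cong (_∪ ⁅ j ⁆) (x∈p∧x≢y⇒p-x-y∪⁅x⁆≡p-y u∈X u≢i) ⟩
      (X - i) ∪ ⁅ j ⁆                  ∎

  exchange : Acc _<_ ∣ Y ∣ → Feasible _≼_ X A → Feasible _≼_ Y B → i ∈ X → i ∉ Y →
             ∃₂ λ X′ Y′ → Exchanged X Y i X′ Y′ × Rematch A B X′ Y′
  exchange {Y} {X} {A} {B} {i} (acc smaller) FA FB i∈X i∉Y
    with partner FA i∈X
  ... | v , Aiv with any? (λ u → B u v ≟ᵇ true)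
  ...   | no ¬covered = _ , _ , drop , moveEdge FA FB Aiv (λ x Bxv → ¬covered (x , Bxv)) i∉Y
  ...   | yes (u , Buv) with u ∈? X
  ...     | no u∉X =
    _ , _ , swap u u∈Y u∉X ,
    subst (Rematch A B _) (x≢y⇒p-x∪⁅y⁆≡p∪⁅y⁆-x u≢i)
      (extendRematch FA FB Aiv Buv (A , _ , FA , FB⁻ , λ _ → refl)
                     (i∉Y ∘ p─q⊆p Y ⁅ u ⁆) u∉X)
    where
    u∈Y = covered FB Buv
    u≢i = x∈p∧y∉p⇒x≢y u∈Y i∉Y
    FB⁻ = deleteEdge-feasible FB Buv
  ...     | yes u∈X =
    let (X′ , Y′ , exchanged , rematch) =
          exchange (smaller (x∈p⇒∣p-x∣<∣p∣ u∈Y)) FA (deleteEdge-feasible FB Buv) u∈X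
                   (λ u∈Y-u → x∈p-y⇒x≢y {p = Y} u∈Y-u refl)
        (i∉Y′ , u∉X′ , exchanged′) = Exchanged-extend u∈X u∈Y i∉Y exchanged
    in _ , _ , exchanged′ ,
       extendRematch FA FB Aiv Buv rematch i∉Y′ u∉X′
    where
    u∈Y = covered FB Buv

  maxValue⇒MnatConcave : (f : Subset n → ℕ) → (∀ X → IsMaxValue _≼_ X (f X)) → MnatConcave f
  maxValue⇒MnatConcave f max X Y i i∈X i∉Y =
    let ((A , FA , wA) , _) = max X
        ((B , FB , wB) , _) = max Y
        (X′ , Y′ , exchanged , M₁ , M₂ , F₁ , F₂ , rematch) =
          exchange (<-wellFounded ∣ Y ∣) FA FB i∈X i∉Y
        bound : f X + f Y ≤ f X′ + f Y′
        bound = subst (_≤ f X′ + f Y′)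
                      (trans (weight-⊕ rematch) (cong₂ _+_ wA wB))
                      (+-mono-≤ (proj₂ (max X′) M₁ F₁) (proj₂ (max Y′) M₂ F₂))
    in conclude exchanged bound
    where
    conclude : Exchanged X Y i X′ Y′ → f X + f Y ≤ f X′ + f Y′ →
      (f X + f Y ≤ f (X - i) + f (Y ∪ ⁅ i ⁆)) ⊎
      (∃ λ j → j ∈ Y × j ∉ X × (f X + f Y ≤ f ((X - i) ∪ ⁅ j ⁆) + f ((Y ∪ ⁅ i ⁆) - j)))
    conclude drop               bound = inj₁ bound
    conclude (swap j j∈Y j∉X) bound = inj₂ (j , j∈Y , j∉X , bound)

iterate : ∀ {A : Set} → (A → A) → ℕ → A → A
iterate f zero    x = x
iterate f (suc k) x = iterate f k (f x)

iterate-∘ : ∀ {A : Set} (f : A → A) k x → iterate f k (f x) ≡ f (iterate f k x)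
iterate-∘ f zero    x = refl
iterate-∘ f (suc k) x = iterate-∘ f k (f x)

iterate-cancelˡ : ∀ {A : Set} {f : A → A} → Injective _≡_ _≡_ f →
                  ∀ s d x → iterate f s x ≡ iterate f (s + d) x → x ≡ iterate f d x
iterate-cancelˡ inj zero    d x eq = eq
iterate-cancelˡ {f = f} inj (suc s) d x eq =
  inj (trans (iterate-cancelˡ inj s d (f x) eq) (iterate-∘ f d x))

injective⇒periodic : ∀ {n} {f : Fin n → Fin n} → Injective _≡_ _≡_ f →
                     ∀ x → ∃ λ d → iterate f (suc d) x ≡ x
injective⇒periodic {n} {f} inj x =
  let (s , t , s<t , eq) = pigeonhole (n<1+n n) (λ k → iterate f (toℕ k) x)
      (d , 1+s+d≡t) = m≤n⇒∃[o]m+o≡n s<t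
      t≡s+1+d = trans (sym 1+s+d≡t) (sym (+-suc (toℕ s) d))
  in d , sym (iterate-cancelˡ inj (toℕ s) (suc d) x
                (trans eq (cong (λ k → iterate f k x) t≡s+1+d)))

module _ {n : ℕ} {_≼_ : Fin n → Fin n → Set} (po : IsPartialOrder _≡_ _≼_) where

  open IsPartialOrder po using (antisym; reflexive) renaming (trans to ≼-trans)
  open Exchange _≼_
    using (Uncovered; covered; partner; deleteEdge-feasible; insertEdge-feasible)

  private variable
    X : Subset n
    M : EdgeSet n
    x y : Fin n

  iterate-≼ : ∀ {f : Fin n → Fin n} → (∀ x → f x ≼ x) → ∀ k x → iterate f k x ≼ x
  iterate-≼     deflationary zero    x = reflexive refl
  iterate-≼ {f} deflationary (suc k) x =
    ≼-trans (iterate-≼ deflationary k (f x)) (deflationary x)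

  deflationary-injection⇒≗id : ∀ {f : Fin n → Fin n} → Injective _≡_ _≡_ f →
                               (∀ x → f x ≼ x) → ∀ x → f x ≡ x
  deflationary-injection⇒≗id {f} inj deflationary x =
    let (d , periodic) = injective⇒periodic inj x
    in antisym (deflationary x) (subst (_≼ f x) periodic (iterate-≼ deflationary d (f x)))

  ideal⇒diagonal : IsIdeal _≼_ X → Feasible _≼_ X M → ∀ x y → M x y ≡ true → x ≡ y
  ideal⇒diagonal {X} {M} ideal F@(inE₀ , (rowUnique , colUnique) , _) x y Mxy =
    edge-fixed (x ∈? X) (deflationary-injection⇒≗id τ-injective (λ a → τ′-≼ a (a ∈? X)) x)
    where
    τ′ : ∀ a → Dec (a ∈ X) → Fin n
    τ′ a (yes a∈X) = proj₁ (partner F a∈X)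
    τ′ a (no  _)   = a
    τ′-≼ : ∀ a d → τ′ a d ≼ a
    τ′-≼ a (yes a∈X) = inE₀ a _ (proj₂ (partner F a∈X))
    τ′-≼ a (no  _)   = reflexive refl
    τ′-∈ : ∀ {a} → (a∈X : a ∈ X) → τ′ a (yes a∈X) ∈ X
    τ′-∈ {a} a∈X = ideal _ a (τ′-≼ a (yes a∈X)) a∈X
    τ′-injective : ∀ a b da db → τ′ a da ≡ τ′ b db → a ≡ b
    τ′-injective a b (yes a∈X) (yes b∈X) eq =
      colUnique a b _ (proj₂ (partner F a∈X))
        (subst (λ c → M b c ≡ true) (sym eq) (proj₂ (partner F b∈X)))
    τ′-injective a b (yes a∈X) (no b∉X) eq = contradiction (subst (_∈ X) eq (τ′-∈ a∈X)) b∉X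
    τ′-injective a b (no a∉X) (yes b∈X) eq = contradiction (subst (_∈ X) (sym eq) (τ′-∈ b∈X)) a∉X
    τ′-injective a b (no _)   (no _)    eq = eq
    τ-injective : Injective _≡_ _≡_ (λ a → τ′ a (a ∈? X))
    τ-injective {a} {b} = τ′-injective a b (a ∈? X) (b ∈? X)
    edge-fixed : ∀ d → τ′ x d ≡ x → x ≡ y
    edge-fixed (yes x∈X) fixed = trans (sym fixed) (rowUnique x _ y (proj₂ (partner F x∈X)) Mxy)
    edge-fixed (no  x∉X) _     = contradiction (covered F Mxy) x∉X

  ideal⇒maxValue≡0 : ∀ {v} → IsIdeal _≼_ X → IsMaxValue _≼_ X v → v ≡ 0
  ideal⇒maxValue≡0 ideal ((M , F , wM) , _) =
    trans (sym wM) (weight-diagonal (ideal⇒diagonal ideal F))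

  identityOn : Subset n → EdgeSet n
  identityOn X a b with a ∈? X | a ≟ b
  ... | yes _ | yes _ = true
  ... | _     | _     = false

  identityOn⁻ : ∀ {a b} → identityOn X a b ≡ true → a ∈ X × a ≡ b
  identityOn⁻ {X} {a} {b} e with a ∈? X | a ≟ b
  ... | yes a∈X | yes a≡b = a∈X , a≡b
  ... | yes _   | no  _   = contradiction e λ ()
  ... | no  _   | _       = contradiction e λ ()

  identityOn-refl : ∀ {a} → a ∈ X → identityOn X a a ≡ true
  identityOn-refl {X} {a} a∈X with a ∈? X | a ≟ a
  ... | yes _ | yes _   = refl
  ... | yes _ | no  a≢a = contradiction refl a≢a
  ... | no  a∉X | _     = contradiction a∈X a∉X

  identityOn-feasible : Feasible _≼_ X (identityOn X)
  identityOn-feasible =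
    (λ a b e → reflexive (sym (proj₂ (identityOn⁻ e)))) ,
    ((λ a b b′ e e′ → trans (sym (proj₂ (identityOn⁻ e))) (proj₂ (identityOn⁻ e′))) ,
     (λ a a′ b e e′ → trans (proj₂ (identityOn⁻ e)) (sym (proj₂ (identityOn⁻ e′))))) ,
    λ a → mk⇔ (λ a∈X → a , identityOn-refl a∈X) (λ (_ , e) → proj₁ (identityOn⁻ e))

  positiveMatching : x ≼ y → y ∈ X → x ∉ X → ∃ λ M → Feasible _≼_ X M × 0 < weight M
  positiveMatching {x} {y} {X} x≼y y∈X x∉X =
    insertEdge y x I⁻ ,
    subst (λ X′ → Feasible _≼_ X′ (insertEdge y x I⁻)) (x∈p⇒p-x∪⁅x⁆≡p y∈X)
      (insertEdge-feasible (deleteEdge-feasible identityOn-feasible (identityOn-refl y∈X))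
                           (λ y∈X-y → x∈p-y⇒x≢y {p = X} y∈X-y refl) x-free x≼y) ,
    subst (_≤ weight (insertEdge y x I⁻)) (w₀-≢ (x∈p∧y∉p⇒x≢y y∈X x∉X))
          (w₀≤weight (setEdge-hit y x true I⁻))
    where
    I⁻ = deleteEdge y y (identityOn X)
    x-free : Uncovered I⁻ x
    x-free z e = let (z∈X , z≡x) = identityOn⁻ (proj₁ (deleteEdge⁻ y y z x e))
                 in x∉X (subst (_∈ X) z≡x z∈X)

  maxValue≡0⇒ideal : IsMaxValue _≼_ X 0 → IsIdeal _≼_ X
  maxValue≡0⇒ideal {X} (_ , maximal) x y x≼y y∈X with x ∈? X
  ... | yes x∈X = x∈X
  ... | no  x∉X = let (M , F , positive) = positiveMatching x≼y y∈X x∉X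
                  in contradiction (≤-trans positive (maximal M F)) λ ()

lemma6 : (n : ℕ) (_≼_ : Fin n → Fin n → Set) → IsPartialOrder _≡_ _≼_ →
         (f₀ : Subset n → ℕ) → (∀ X → IsMaxValue _≼_ X (f₀ X)) →
         MnatConcave f₀ ×
         (∀ X → (IsIdeal _≼_ X → f₀ X ≡ 0) × (¬ IsIdeal _≼_ X → 0 < f₀ X))
lemma6 n _≼_ po f₀ max =
  Exchange.maxValue⇒MnatConcave _≼_ f₀ max ,
  λ X → (λ ideal → ideal⇒maxValue≡0 po ideal (max X)) ,
        (λ ¬ideal → n≢0⇒n>0 λ f₀X≡0 →
           ¬ideal (maxValue≡0⇒ideal po (subst (IsMaxValue _≼_ X) f₀X≡0 (max X))))
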